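{- Let $a,b\ge 2$ be integers, let $n\ge 6$, and let $r=a$ if $n$ is even and $r=b$ if $n$ is odd. Then $$f_{(a,b,n)}^2 = f_{(a,b,n-1)}^{r}\, I_{(a,b,n-1)}\, t_{(a,b,n-1)}^{r-1}.$$
   Context: Words are over the alphabet $\{0,1\}$, with concatenation as the product; $w^k$ denotes the concatenation of $k$ copies of $w$ ($w^0$ is the empty word). For integers $a,b\ge 1$ the biperiodic Fibonacci words are defined by $f_{(a,b,0)}=0$, $f_{(a,b,1)}=0^{a-1}1$, and for $n\ge 2$: $f_{(a,b,n)} = f_{(a,b,n-1)}^{a}f_{(a,b,n-2)}$ if $n$ is even, and $f_{(a,b,n)} = f_{(a,b,n-1)}^{b}f_{(a,b,n-2)}$ if $n$ is odd. For a word $f_{(a,b,n)}$ with at least two letters, write $f_{(a,b,n)} = p\,xy$ with $x,y$ letters; then $t_{(a,b,n)} := p\,yx$. For $m\ge 5$ let $r_m = a$ if $m$ is even and $r_m=b$ if $m$ is odd, and let $s_m$ be the other one. With $a,b\ge 2$, $f_{(a,b,m)}$ has suffix $w_m := f_{(a,b,m-1)}^{r_m-2}f_{(a,b,m-2)}$ and $t_{(a,b,m)}$ has prefix $w_m$. The word $I_{(a,b,m)}$ is defined as the word which begins with $f_{(a,b,m)}$ and ends with $t_{(a,b,m)}$, where these two occurrences overlap in exactly $w_m$; i.e. $I_{(a,b,m)} = u\,w_m\,v$ where $f_{(a,b,m)}=u\,w_m$ and $t_{(a,b,m)} = w_m\,v$. -}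

module Defs where

open import Data.Nat using (ℕ; zero; suc; _∸_; _+_; _%_; _≡ᵇ_)
open import Data.Bool using (Bool; true; false; if_then_else_)
open import Data.List using (List; []; _∷_; _++_; length; take; drop)

-- Letters of the alphabet {0,1}: false = 0, true = 1.
Word : Set
Word = List Bool

infixl 8 _^ʷ_
_^ʷ_ : Word → ℕ → Word
w ^ʷ zero  = []
w ^ʷ suc k = w ++ (w ^ʷ k)

isEven : ℕ → Bool
isEven n = (n % 2) ≡ᵇ 0

rr : ℕ → ℕ → ℕ → ℕ
rr a b m = if isEven m then a else b

fib : ℕ → ℕ → ℕ → Word
fib a b zero = false ∷ []
fib a b (suc zero) = (false ∷ []) ^ʷ (a ∸ 1) ++ (true ∷ [])
fib a b (suc (suc n)) =
  fib a b (suc n) ^ʷ rr a b (suc (suc n)) ++ fib a b n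

swapLast2 : Word → Word
swapLast2 [] = []
swapLast2 (x ∷ []) = x ∷ []
swapLast2 (x ∷ y ∷ []) = y ∷ x ∷ []
swapLast2 (x ∷ y ∷ z ∷ p) = x ∷ swapLast2 (y ∷ z ∷ p)

tw : ℕ → ℕ → ℕ → Word
tw a b n = swapLast2 (fib a b n)

ww : ℕ → ℕ → ℕ → Word
ww a b m = fib a b (m ∸ 1) ^ʷ (rr a b m ∸ 2) ++ fib a b (m ∸ 2)

-- I_(a,b,m) = u w_m v where f_m = u w_m and t_m = w_m v
-- (u = f_m with its suffix w_m removed, v = t_m with its prefix w_m removed)
II : ℕ → ℕ → ℕ → Word
II a b m =
  take (length (fib a b m) ∸ length (ww a b m)) (fib a b m)
  ++ tw a b m

-- Writing F = f_(n-1), G = f_(n-2) and r = r_n, we have f_n = F^r G.  The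
-- consecutive Fibonacci words almost commute: F G and G F differ only by a
-- swap of the last two letters, i.e. F G = G t_(n-1), and therefore
-- F^r G = G t_(n-1)^r.  Hence
--   f_n f_n = F^r (G F^r G) = F^r G G t_(n-1)^r,
-- and I_(n-1) = G G t_(n-1), because f_(n-1) = G G w_(n-1).
module Submission where

open import Defs
open import Data.Nat using (ℕ; zero; suc; _≤_; _∸_; s≤s)
open import Data.Nat.Properties using (m+n∸n≡m)
open import Data.Bool using (true; false)
open import Data.List using ([]; _∷_; _++_; take; length)
open import Data.List.Properties using (++-assoc; ++-identityʳ; length-++)
open import Relation.Binary.PropositionalEquality
  using (_≡_; refl; sym; trans; cong; module ≡-Reasoning)
open ≡-Reasoning

data Long : Word → Set where
  long : ∀ x y p → Long (x ∷ y ∷ p)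

Long-∷ : ∀ x {w} → Long w → Long (x ∷ w)
Long-∷ x (long u v p) = long x u (v ∷ p)

Long-++ˡ : ∀ {x} y → Long x → Long (x ++ y)
Long-++ˡ y (long u v p) = long u v (p ++ y)

Long-++ʳ : ∀ x {y} → Long y → Long (x ++ y)
Long-++ʳ []      l = l
Long-++ʳ (u ∷ x) l = Long-∷ u (Long-++ʳ x l)

Long-swapLast2 : ∀ x y p → Long (swapLast2 (x ∷ y ∷ p))
Long-swapLast2 x y []      = long y x []
Long-swapLast2 x y (z ∷ p) = Long-∷ x (Long-swapLast2 y z p)

swapLast2-∷ : ∀ x {w} → Long w → swapLast2 (x ∷ w) ≡ x ∷ swapLast2 w
swapLast2-∷ x (long y z [])      = refl
swapLast2-∷ x (long y z (_ ∷ _)) = refl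

swapLast2-++ : ∀ x {y} → Long y → swapLast2 (x ++ y) ≡ x ++ swapLast2 y
swapLast2-++ []      l = refl
swapLast2-++ (u ∷ x) l =
  trans (swapLast2-∷ u (Long-++ʳ x l)) (cong (u ∷_) (swapLast2-++ x l))

swapLast2-involutive : ∀ w → swapLast2 (swapLast2 w) ≡ w
swapLast2-involutive []              = refl
swapLast2-involutive (x ∷ [])        = refl
swapLast2-involutive (x ∷ y ∷ [])    = refl
swapLast2-involutive (x ∷ y ∷ z ∷ p) =
  trans (swapLast2-∷ x (Long-swapLast2 y z p))
        (cong (x ∷_) (swapLast2-involutive (y ∷ z ∷ p)))

^ʷ-comm : ∀ w r → w ++ w ^ʷ r ≡ w ^ʷ r ++ w
^ʷ-comm w zero    = ++-identityʳ w
^ʷ-comm w (suc r) =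
  trans (cong (w ++_) (^ʷ-comm w r)) (sym (++-assoc w (w ^ʷ r) w))

^ʷ-conjugate : ∀ {x y z : Word} r → x ++ y ≡ y ++ z → x ^ʷ r ++ y ≡ y ++ z ^ʷ r
^ʷ-conjugate {y = y} zero    _  = sym (++-identityʳ y)
^ʷ-conjugate {x} {y} {z} (suc r) xy≡yz = begin
  (x ++ x ^ʷ r) ++ y   ≡⟨ ++-assoc x (x ^ʷ r) y ⟩
  x ++ (x ^ʷ r ++ y)   ≡⟨ cong (x ++_) (^ʷ-conjugate r xy≡yz) ⟩
  x ++ (y ++ z ^ʷ r)   ≡⟨ sym (++-assoc x y (z ^ʷ r)) ⟩
  (x ++ y) ++ z ^ʷ r   ≡⟨ cong (_++ z ^ʷ r) xy≡yz ⟩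
  (y ++ z) ++ z ^ʷ r   ≡⟨ ++-assoc y z (z ^ʷ r) ⟩
  y ++ (z ++ z ^ʷ r)   ∎

^ʷ-split₂ : ∀ (w : Word) {r} → 2 ≤ r → w ^ʷ r ≡ (w ++ w) ++ w ^ʷ (r ∸ 2)
^ʷ-split₂ w {suc (suc r)} (s≤s (s≤s _)) = sym (++-assoc w w (w ^ʷ r))

take-prefix : ∀ {z} (x y : Word) → z ≡ x ++ y → take (length z ∸ length y) z ≡ x
take-prefix x y refl
  rewrite length-++ x {y} | m+n∸n≡m (length x) (length y) = take-++-length x y
  where
  take-++-length : ∀ (x y : Word) → take (length x) (x ++ y) ≡ x
  take-++-length []      y = refl
  take-++-length (u ∷ x) y = cong (u ∷_) (take-++-length x y)

rr-≥2 : ∀ {a b} m → 2 ≤ a → 2 ≤ b → 2 ≤ rr a b m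
rr-≥2 m ha hb with isEven m
... | true  = ha
... | false = hb

swapLast2-0^j01 : ∀ j → swapLast2 (false ∷ ((false ∷ []) ^ʷ j ++ true ∷ []))
                       ≡ ((false ∷ []) ^ʷ j ++ true ∷ []) ++ false ∷ []
swapLast2-0^j01 j = begin
  swapLast2 ((o ++ o ^ʷ j) ++ true ∷ [])
    ≡⟨ cong (λ u → swapLast2 (u ++ true ∷ [])) (^ʷ-comm o j) ⟩
  swapLast2 ((o ^ʷ j ++ o) ++ true ∷ [])
    ≡⟨ cong swapLast2 (++-assoc (o ^ʷ j) o (true ∷ [])) ⟩
  swapLast2 (o ^ʷ j ++ false ∷ true ∷ [])
    ≡⟨ swapLast2-++ (o ^ʷ j) (long false true []) ⟩
  o ^ʷ j ++ true ∷ false ∷ []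
    ≡⟨ sym (++-assoc (o ^ʷ j) (true ∷ []) o) ⟩
  (o ^ʷ j ++ true ∷ []) ++ o
    ∎
  where
  o : Word
  o = false ∷ []

Long-fib-1 : ∀ {a} b → 2 ≤ a → Long (fib a b 1)
Long-fib-1 {suc (suc zero)}    _ (s≤s (s≤s _)) = long false true []
Long-fib-1 {suc (suc (suc _))} _ (s≤s (s≤s _)) = long false false _

module _ {a b : ℕ} (ha : 2 ≤ a) (hb : 2 ≤ b) where

  private
    f : ℕ → Word
    f = fib a b

  Long-fib : ∀ k → Long (f (suc k))
  Long-fib zero = Long-fib-1 b ha
  Long-fib (suc k) with rr a b (suc (suc k)) | rr-≥2 (suc (suc k)) ha hb
  ... | suc r | _ = Long-++ˡ (f k) (Long-++ˡ (f (suc k) ^ʷ r) (Long-fib k))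

  swapLast2-fib-++-fib : ∀ k → swapLast2 (f k ++ f (suc k)) ≡ f (suc k) ++ f k
  swapLast2-fib-++-fib zero = swapLast2-0^j01 (a ∸ 1)
  swapLast2-fib-++-fib (suc k) = begin
    swapLast2 (F ++ (F ^ʷ r ++ G))   ≡⟨ cong swapLast2 (F-^ʷ-comm-++ G) ⟩
    swapLast2 (F ^ʷ r ++ (F ++ G))   ≡⟨ swapLast2-++ (F ^ʷ r) (Long-++ˡ G (Long-fib k)) ⟩
    F ^ʷ r ++ swapLast2 (F ++ G)
      ≡⟨ cong (λ u → F ^ʷ r ++ swapLast2 u) (sym (swapLast2-fib-++-fib k)) ⟩
    F ^ʷ r ++ swapLast2 (swapLast2 (G ++ F))
      ≡⟨ cong (F ^ʷ r ++_) (swapLast2-involutive (G ++ F)) ⟩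
    F ^ʷ r ++ (G ++ F)               ≡⟨ sym (++-assoc (F ^ʷ r) G F) ⟩
    (F ^ʷ r ++ G) ++ F               ∎
    where
    F G : Word
    F = f (suc k)
    G = f k
    r : ℕ
    r = rr a b (suc (suc k))
    F-^ʷ-comm-++ : ∀ u → F ++ (F ^ʷ r ++ u) ≡ F ^ʷ r ++ (F ++ u)
    F-^ʷ-comm-++ u = begin
      F ++ (F ^ʷ r ++ u)  ≡⟨ sym (++-assoc F (F ^ʷ r) u) ⟩
      (F ++ F ^ʷ r) ++ u  ≡⟨ cong (_++ u) (^ʷ-comm F r) ⟩
      (F ^ʷ r ++ F) ++ u  ≡⟨ ++-assoc (F ^ʷ r) F u ⟩
      F ^ʷ r ++ (F ++ u)  ∎

  fib-++-fib : ∀ k → f (suc k) ++ f k ≡ f k ++ tw a b (suc k)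
  fib-++-fib k = begin
    f (suc k) ++ f k                 ≡⟨ sym (swapLast2-fib-++-fib k) ⟩
    swapLast2 (f k ++ f (suc k))     ≡⟨ swapLast2-++ (f k) (Long-fib k) ⟩
    f k ++ tw a b (suc k)            ∎

  fib-≡-square-++-ww : ∀ k →
    f (suc (suc k)) ≡ (f (suc k) ++ f (suc k)) ++ ww a b (suc (suc k))
  fib-≡-square-++-ww k = begin
    F ^ʷ r ++ f k
      ≡⟨ cong (_++ f k) (^ʷ-split₂ F (rr-≥2 (suc (suc k)) ha hb)) ⟩
    ((F ++ F) ++ F ^ʷ (r ∸ 2)) ++ f k    ≡⟨ ++-assoc (F ++ F) (F ^ʷ (r ∸ 2)) (f k) ⟩
    (F ++ F) ++ (F ^ʷ (r ∸ 2) ++ f k)    ∎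
    where
    F : Word
    F = f (suc k)
    r : ℕ
    r = rr a b (suc (suc k))

  II-≡ : ∀ k → II a b (suc (suc k)) ≡ f (suc k) ++ f (suc k) ++ tw a b (suc (suc k))
  II-≡ k = begin
    take (length Fm ∸ length W) Fm ++ T ≡⟨ cong (_++ T) (take-prefix (F ++ F) W (fib-≡-square-++-ww k)) ⟩
    (F ++ F) ++ T                       ≡⟨ ++-assoc F F T ⟩
    F ++ F ++ T                         ∎
    where
    F Fm W T : Word
    F  = f (suc k)
    Fm = f (suc (suc k))
    W  = ww a b (suc (suc k))
    T  = tw a b (suc (suc k))

  fib-square : ∀ k → let n = suc (suc (suc k)) in
    f n ++ f n ≡ f (n ∸ 1) ^ʷ rr a b n ++ II a b (n ∸ 1) ++ tw a b (n ∸ 1) ^ʷ (rr a b n ∸ 1)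
  fib-square k with rr a b (suc (suc (suc k))) | rr-≥2 (suc (suc (suc k))) ha hb
  ... | suc r | _ = begin
    (F ^ʷ suc r ++ G) ++ (F ^ʷ suc r ++ G)   ≡⟨ ++-assoc (F ^ʷ suc r) G _ ⟩
    F ^ʷ suc r ++ (G ++ (F ^ʷ suc r ++ G))
      ≡⟨ cong (λ u → F ^ʷ suc r ++ (G ++ u)) (^ʷ-conjugate {F} {G} {T} (suc r) (fib-++-fib (suc k))) ⟩
    F ^ʷ suc r ++ (G ++ (G ++ (T ++ T ^ʷ r)))
      ≡⟨ cong (F ^ʷ suc r ++_) (sym (GGT-++ (T ^ʷ r))) ⟩
    F ^ʷ suc r ++ ((G ++ G ++ T) ++ T ^ʷ r)
      ≡⟨ cong (λ u → F ^ʷ suc r ++ (u ++ T ^ʷ r)) (sym (II-≡ k)) ⟩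
    F ^ʷ suc r ++ II a b (suc (suc k)) ++ T ^ʷ r ∎
    where
    F G T : Word
    F = f (suc (suc k))
    G = f (suc k)
    T = tw a b (suc (suc k))
    GGT-++ : ∀ u → (G ++ G ++ T) ++ u ≡ G ++ (G ++ (T ++ u))
    GGT-++ u = trans (++-assoc G (G ++ T) u) (cong (G ++_) (++-assoc G T u))

-- The identity already holds for n ≥ 3; the hypothesis 6 ≤ n is only used in that weaker form.
mainTheorem4 : (a b n : ℕ) → 2 ≤ a → 2 ≤ b → 6 ≤ n →
    fib a b n ++ fib a b n
    ≡ fib a b (n ∸ 1) ^ʷ rr a b n ++ II a b (n ∸ 1) ++ tw a b (n ∸ 1) ^ʷ (rr a b n ∸ 1)
mainTheorem4 a b (suc (suc (suc k))) ha hb (s≤s (s≤s (s≤s _))) = fib-square ha hb k
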